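{- Let $d\ge2$ and let $A,B\subset\mathbb R^d$ be finite with $A$ nonempty, such that $x+A\subset\operatorname{int}[B]$ for some $x\in\mathbb R^d$, and such that $[B]$ is a $d$-dimensional prism over a simplex whose vertical edges are parallel. Then $|A+B|>(d+1)|A|$.
   Context: $[B]$ is the convex hull of $B$, $\operatorname{int}$ the interior. A $d$-dimensional prism over a simplex is the convex hull of two $(d-1)$-simplices $[v_0,\dots,v_{d-1}]$ and $[w_0,\dots,w_{d-1}]$, combinatorially equivalent to a $(d-1)$-simplex times a segment, whose vertical edges are $[v_i,w_i]$. -}

module Defs where

open import Level using (0ℓ)
open import Data.Nat as ℕ using (ℕ; zero; suc)
open import Data.Fin using (Fin; zero; suc)
open import Data.Vec as V using (Vec; lookup; zipWith; replicate; map)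
open import Data.List as L using (List; length)
open import Data.Product using (Σ; ∃; _×_; _,_)
open import Relation.Binary.PropositionalEquality using (_≡_; _≢_)
open import Relation.Binary.Structures using (IsStrictTotalOrder)
open import Algebra.Structures using (IsCommutativeRing)
open import Data.Sum using (_⊎_)
open import Data.List.Membership.Propositional using (_∈_)
open import Data.List.Relation.Unary.Unique.Propositional using (Unique)

-- The real numbers, axiomatised as a complete ordered field.
-- (Every structure satisfying these axioms is isomorphic to ℝ, so
-- quantifying over all of them is the same as speaking about ℝ.)

record RealField : Set₁ where
  infixl 6 _+_
  infixl 7 _*_
  infix  4 _<_ _≤_
  field
    Carrier : Set
    _+_ _*_ : Carrier → Carrier → Carrier
    -_      : Carrier → Carrier
    0# 1#   : Carrier
    _<_     : Carrier → Carrier → Set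
    isCommutativeRing : IsCommutativeRing _≡_ _+_ _*_ -_ 0# 1#
    0≢1     : 0# ≢ 1#
    inverse : ∀ x → x ≢ 0# → ∃ λ y → x * y ≡ 1#
    isStrictTotalOrder : IsStrictTotalOrder _≡_ _<_
    +-mono-< : ∀ {x y} z → x < y → x + z < y + z
    *-pos    : ∀ {x y} → 0# < x → 0# < y → 0# < x * y

  _≤_ : Carrier → Carrier → Set
  x ≤ y = x < y ⊎ x ≡ y

  field
    complete : (P : Carrier → Set) → (∃ λ x → P x) →
               (∃ λ b → ∀ x → P x → x ≤ b) →
               ∃ λ s → (∀ x → P x → x ≤ s) ×
                       (∀ b → (∀ x → P x → x ≤ b) → s ≤ b)

module Geometry (R : RealField) where
  open RealField R

  _-_ : Carrier → Carrier → Carrier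
  x - y = x + (- y)

  Point : ℕ → Set
  Point d = Vec Carrier d

  _+ᵥ_ : ∀ {d} → Point d → Point d → Point d
  _+ᵥ_ = zipWith _+_

  _·ᵥ_ : ∀ {d} → Carrier → Point d → Point d
  c ·ᵥ p = map (c *_) p

  0ᵥ : ∀ {d} → Point d
  0ᵥ = replicate _ 0#

  sum : ∀ {n} → (Fin n → Carrier) → Carrier
  sum {zero}  f = 0#
  sum {suc n} f = f zero + sum (λ i → f (suc i))

  vsum : ∀ {n d} → (Fin n → Point d) → Point d
  vsum {zero}  f = 0ᵥ
  vsum {suc n} f = f zero +ᵥ vsum (λ i → f (suc i))

  InConvF : ∀ {n d} → (Fin n → Point d) → Point d → Set
  InConvF f y = ∃ λ (λs : Fin _ → Carrier) →
    (∀ i → 0# ≤ λs i) × sum λs ≡ 1# × y ≡ vsum (λ i → λs i ·ᵥ f i)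

  -- y ∈ [B]  (convex hull of the finite set B, given as a list)
  InHull : ∀ {d} → List (Point d) → Point d → Set
  InHull B y = InConvF (L.lookup B) y

  InInterior : ∀ {d} → List (Point d) → Point d → Set
  InInterior {d} B y = ∃ λ ε → 0# < ε ×
    (∀ (z : Point d) →
       (∀ i → (- ε < lookup z i - lookup y i) × (lookup z i - lookup y i < ε)) →
       InHull B z)

  InConv2 : ∀ {d} → (Fin d → Point d) → (Fin d → Point d) → Point d → Set
  InConv2 v w y = ∃ λ (α : Fin _ → Carrier) → ∃ λ (β : Fin _ → Carrier) →
    (∀ i → 0# ≤ α i) × (∀ i → 0# ≤ β i) × sum α + sum β ≡ 1# ×
    y ≡ vsum (λ i → α i ·ᵥ v i) +ᵥ vsum (λ i → β i ·ᵥ w i)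

  -- [B] is a d-dimensional prism over a simplex with parallel vertical
  -- edges [v_i, w_i]: the base vertices v_0,…,v_{d-1} are affinely
  -- independent, the common edge direction u is transversal to their
  -- affine hull, w_i = v_i + t_i u with t_i > 0, and
  -- [B] = [v_0,…,v_{d-1},w_0,…,w_{d-1}].
  IsParallelPrism : ∀ {d} → List (Point d) → Set
  IsParallelPrism {d} B =
    ∃ λ (v : Fin d → Point d) → ∃ λ (w : Fin d → Point d) →
    ∃ λ (u : Point d) → ∃ λ (t : Fin d → Carrier) →
      (∀ (λs : Fin d → Carrier) (c : Carrier) → sum λs ≡ 0# →
         vsum (λ i → λs i ·ᵥ v i) +ᵥ (c ·ᵥ u) ≡ 0ᵥ →
         c ≡ 0# × (∀ i → λs i ≡ 0#)) ×
      (∀ i → 0# < t i) ×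
      (∀ i → w i ≡ v i +ᵥ (t i ·ᵥ u)) ×
      (∀ y → (InHull B y → InConv2 v w y) × (InConv2 v w y → InHull B y))

  InSumset : ∀ {d} → List (Point d) → List (Point d) → Point d → Set
  InSumset A B p = ∃ λ a → ∃ λ b → a ∈ A × b ∈ B × p ≡ a +ᵥ b

  SumsetSizeExceeds : ∀ {d} → List (Point d) → List (Point d) → ℕ → Set
  SumsetSizeExceeds A B k = ∃ λ S →
    Unique S × (∀ {p} → p ∈ S → InSumset A B p) × k ℕ.< length S

module Submission where

-- Write the points of the prism [B] in prism coordinates (ℓ, h): ℓ barycentric over the base simplex,
-- h the height along the common edge direction, 0 ≤ h ≤ Σ ℓᵢ tᵢ. These coordinates are additive and
-- unique, every corner of the prism belongs to B, and a point x + a interior to [B] has h > 0 and all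
-- ℓᵢ < 1. Translate A by the d base corners and by the top corner over a tallest edge i*: a translate
-- by a corner over edge i is recognised by ℓᵢ ≥ 1, and a top translate lies strictly higher than any
-- base translate, so the (d + 1)|A| points are distinct. The top corner over another edge, added to
-- the highest point of A, lies higher than every base translate over that edge and so is new.

open import Level using (0ℓ)
open import Data.Empty using (⊥-elim)
open import Data.Fin as Fin using (Fin; zero; suc)
open import Data.Fin.Properties using (combine-remQuot)
open import Data.List as L using (List; []; _∷_; length)
open import Data.List.Properties using (length-tabulate)
open import Data.List.Membership.Propositional using (_∈_)
open import Data.List.Membership.Propositional.Properties using (∈-lookup; ∈-tabulate⁻)
import Data.List.Relation.Unary.All as All
import Data.List.Relation.Unary.All.Properties as All
open import Data.List.Relation.Unary.AllPairs using (_∷_)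
open import Data.List.Relation.Unary.Any using (here; there)
open import Data.List.Relation.Unary.Unique.Propositional using (Unique)
import Data.List.Relation.Unary.Unique.Propositional.Properties as Unique
open import Data.Maybe using (Maybe; just; nothing)
open import Data.Nat as ℕ using (ℕ; zero; suc)
import Data.Nat.Properties as ℕₚ
open import Data.Product using (∃; _×_; _,_; proj₁; proj₂; uncurry; map₂)
open import Data.Sum using (inj₁; inj₂; [_,_]′)
open import Data.Vec using (lookup)
import Data.Vec.Properties as Vec
open import Function using (_∘_)
open import Relation.Nullary using (¬_; yes; no)
open import Relation.Nullary.Decidable using (decidable-stable)
open import Relation.Binary.Definitions using (tri<; tri≈; tri>)
open import Relation.Binary.PropositionalEquality
open import Relation.Binary.Bundles using (StrictTotalOrder)
import Relation.Binary.Reasoning.StrictPartialOrder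
open import Algebra.Bundles using (CommutativeRing; RawRing)
open import Algebra.Solver.Ring.AlmostCommutativeRing using (fromCommutativeRing; _-Raw-AlmostCommutative⟶_)

open import Defs

another-index : ∀ {d} → 2 ℕ.≤ d → (i : Fin d) → ∃ λ j → i ≢ j
another-index {suc zero} (ℕ.s≤s ()) zero
another-index {suc (suc _)} _ zero = suc zero , λ ()
another-index {suc (suc _)} _ (suc _) = zero , λ ()

nonempty-index : ∀ {X : Set} {xs : List X} → xs ≢ [] → Fin (length xs)
nonempty-index {xs = []} []≢[] = ⊥-elim ([]≢[] refl)
nonempty-index {xs = _ ∷ _} _ = zero

lookup-injective : ∀ {X : Set} {xs : List X} → Unique xs → ∀ {i j} → L.lookup xs i ≡ L.lookup xs j → i ≡ j
lookup-injective (_ ∷ _) {zero} {zero} _ = refl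
lookup-injective (x∉xs ∷ _) {zero} {suc j} eq = ⊥-elim (All.lookup x∉xs (∈-lookup j) eq)
lookup-injective (x∉xs ∷ _) {suc i} {zero} eq = ⊥-elim (All.lookup x∉xs (∈-lookup i) (sym eq))
lookup-injective (_ ∷ xs-unique) {suc i} {suc j} eq = cong suc (lookup-injective xs-unique eq)

remQuot-injective : ∀ {m} n {i j : Fin (m ℕ.* n)} → Fin.remQuot {m} n i ≡ Fin.remQuot n j → i ≡ j
remQuot-injective {m} n {i} {j} eq =
  trans (sym (combine-remQuot {m} n i)) (trans (cong (uncurry Fin.combine) eq) (combine-remQuot {m} n j))

module _ (R : RealField) where
  open RealField R
  open Geometry R

  commutativeRing : CommutativeRing 0ℓ 0ℓ
  commutativeRing = record { isCommutativeRing = isCommutativeRing }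

  strictTotalOrder : StrictTotalOrder 0ℓ 0ℓ 0ℓ
  strictTotalOrder = record { isStrictTotalOrder = isStrictTotalOrder }

  open CommutativeRing commutativeRing
    using (+-comm; +-assoc; *-comm; *-assoc; distribˡ; distribʳ; +-identityˡ; +-identityʳ;
           *-identityˡ; *-identityʳ; -‿inverseʳ; zeroˡ; zeroʳ; ring; semiring; +-abelianGroup;
           +-commutativeSemigroup)
  open import Algebra.Properties.Ring ring using (-‿distribˡ-*; -‿distribʳ-*; -‿involutive; -0#≈0#)
  open import Algebra.Properties.AbelianGroup +-abelianGroup using (⁻¹-∙-comm; ∙-cancelʳ)
  open import Algebra.Properties.CommutativeSemigroup +-commutativeSemigroup using (interchange)
  open StrictTotalOrder strictTotalOrder using (compare) renaming (asym to <-asym; irrefl to <-irrefl)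
  open import Relation.Binary.Properties.StrictTotalOrder strictTotalOrder
    using () renaming (refl to ≤-refl; trans to ≤-trans; antisym to ≤-antisym; total to ≤-total)
  module ≤-Reasoning = Relation.Binary.Reasoning.StrictPartialOrder (StrictTotalOrder.strictPartialOrder strictTotalOrder)

  -- The ring solver needs coefficients whose equality it can decide by computation; formal differences
  -- (a , b) of naturals, read as a - b, serve.
  module _ where
    open import Algebra.Properties.Semiring.Mult semiring using (×-homo-+; ×1-homo-*) renaming (_×_ to _×ℕ_)
    open ≡-Reasoning

    sub-+ : ∀ a b x y → (a - b) + (x - y) ≡ (a + x) - (b + y)
    sub-+ a b x y = trans (interchange a (- b) x (- y)) (cong ((a + x) +_) (⁻¹-∙-comm b y))

    sub-* : ∀ a b x y → (a - b) * (x - y) ≡ (a * x + b * y) - (a * y + b * x)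
    sub-* a b x y = begin
      (a + - b) * (x + - y)                           ≡⟨ trans (distribʳ _ _ _) (cong₂ _+_ (distribˡ _ _ _) (distribˡ _ _ _)) ⟩
      (a * x + a * - y) + (- b * x + - b * - y)       ≡⟨ cong₂ (λ p q → (a * x + p) + (q + - b * - y)) (sym (-‿distribʳ-* a y)) (sym (-‿distribˡ-* b x)) ⟩
      (a * x + - (a * y)) + (- (b * x) + - b * - y)   ≡⟨ cong (λ z → (a * x + - (a * y)) + (- (b * x) + z)) negated-product ⟩
      (a * x + - (a * y)) + (- (b * x) + b * y)       ≡⟨ cong ((a * x + - (a * y)) +_) (+-comm _ _) ⟩
      (a * x + - (a * y)) + (b * y + - (b * x))       ≡⟨ interchange _ _ _ _ ⟩
      (a * x + b * y) + (- (a * y) + - (b * x))       ≡⟨ cong ((a * x + b * y) +_) (⁻¹-∙-comm _ _) ⟩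
      (a * x + b * y) - (a * y + b * x)               ∎
      where
      negated-product : - b * - y ≡ b * y
      negated-product = trans (sym (-‿distribˡ-* b (- y))) (trans (cong -_ (sym (-‿distribʳ-* b y))) (-‿involutive _))

    neg-sub : ∀ a b → - (a - b) ≡ b - a
    neg-sub a b = trans (sym (⁻¹-∙-comm a (- b))) (trans (cong (- a +_) (-‿involutive b)) (+-comm _ _))

    sub-cross : ∀ a b x y → a + y ≡ b + x → a - b ≡ x - y
    sub-cross a b x y a+y≡b+x = ∙-cancelʳ (b + y) _ _ (begin
      (a - b) + (b + y)   ≡⟨ cancel a b y ⟩
      a + y               ≡⟨ a+y≡b+x ⟩
      b + x               ≡⟨ +-comm b x ⟩
      x + b               ≡⟨ cancel x y b ⟨
      (x - y) + (y + b)   ≡⟨ cong ((x - y) +_) (+-comm y b) ⟩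
      (x - y) + (b + y)   ∎)
      where
      cancel : ∀ p q r → (p - q) + (q + r) ≡ p + r
      cancel p q r = begin
        (p + - q) + (q + r)   ≡⟨ cong ((p + - q) +_) (+-comm q r) ⟩
        (p + - q) + (r + q)   ≡⟨ interchange p (- q) r q ⟩
        (p + r) + (- q + q)   ≡⟨ cong ((p + r) +_) (trans (+-comm (- q) q) (-‿inverseʳ q)) ⟩
        (p + r) + 0#          ≡⟨ +-identityʳ _ ⟩
        p + r                 ∎

    differences : RawRing 0ℓ 0ℓ
    differences = record
      { Carrier = ℕ × ℕ ; _≈_ = _≡_
      ; _+_ = λ (a , b) (x , y) → (a ℕ.+ x , b ℕ.+ y)
      ; _*_ = λ (a , b) (x , y) → (a ℕ.* x ℕ.+ b ℕ.* y , a ℕ.* y ℕ.+ b ℕ.* x)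
      ; -_ = λ (a , b) → (b , a)
      ; 0# = (0 , 0) ; 1# = (1 , 0) }

    ⟦_⟧ : ℕ × ℕ → Carrier
    ⟦ a , b ⟧ = (a ×ℕ 1#) - (b ×ℕ 1#)

    ⟦⟧-homomorphism : differences -Raw-AlmostCommutative⟶ fromCommutativeRing commutativeRing
    ⟦⟧-homomorphism = record
      { ⟦_⟧ = ⟦_⟧
      ; +-homo = λ (a , b) (x , y) → trans (cong₂ _-_ (×-homo-+ 1# a x) (×-homo-+ 1# b y)) (sym (sub-+ _ _ _ _))
      ; *-homo = λ (a , b) (x , y) → trans (cong₂ _-_ (products a x b y) (products a y b x)) (sym (sub-* _ _ _ _))
      ; -‿homo = λ (a , b) → sym (neg-sub _ _)
      ; 0-homo = -‿inverseʳ 0#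
      ; 1-homo = trans (cong₂ _-_ (+-identityʳ 1#) refl) (trans (cong (1# +_) -0#≈0#) (+-identityʳ 1#))
      }
      where
      products : ∀ a x b y → (a ℕ.* x ℕ.+ b ℕ.* y) ×ℕ 1# ≡ (a ×ℕ 1#) * (x ×ℕ 1#) + (b ×ℕ 1#) * (y ×ℕ 1#)
      products a x b y = trans (×-homo-+ 1# (a ℕ.* x) (b ℕ.* y)) (cong₂ _+_ (×1-homo-* a x) (×1-homo-* b y))

    ⟦⟧-equal? : ∀ p q → Maybe (⟦ p ⟧ ≡ ⟦ q ⟧)
    ⟦⟧-equal? (a , b) (x , y) with a ℕ.+ y ℕ.≟ b ℕ.+ x
    ... | yes a+y≡b+x = just (sub-cross _ _ _ _ (trans (sym (×-homo-+ 1# a y)) (trans (cong (_×ℕ 1#) a+y≡b+x) (×-homo-+ 1# b x))))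
    ... | no _ = nothing

  open import Algebra.Solver.Ring differences (fromCommutativeRing commutativeRing) ⟦⟧-homomorphism ⟦⟧-equal?
    using (solve; _:=_; _:+_; _:*_; :-_; _:-_)

  <⇒≱ : ∀ {x y} → x < y → ¬ (y ≤ x)
  <⇒≱ x<y (inj₁ y<x) = <-asym x<y y<x
  <⇒≱ x<y (inj₂ refl) = <-irrefl refl x<y

  +-monoʳ-< : ∀ {x y} z → x < y → z + x < z + y
  +-monoʳ-< {x} {y} z x<y = subst₂ _<_ (+-comm x z) (+-comm y z) (+-mono-< z x<y)

  +-monoˡ-≤ : ∀ {x y} z → x ≤ y → x + z ≤ y + z
  +-monoˡ-≤ z (inj₁ x<y) = inj₁ (+-mono-< z x<y)
  +-monoˡ-≤ z (inj₂ refl) = inj₂ refl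

  +-monoʳ-≤ : ∀ {x y} z → x ≤ y → z + x ≤ z + y
  +-monoʳ-≤ z (inj₁ x<y) = inj₁ (+-monoʳ-< z x<y)
  +-monoʳ-≤ z (inj₂ refl) = inj₂ refl

  +-mono-≤ : ∀ {a b x y} → a ≤ b → x ≤ y → a + x ≤ b + y
  +-mono-≤ {b = b} {x} a≤b x≤y = ≤-trans (+-monoˡ-≤ x a≤b) (+-monoʳ-≤ b x≤y)

  +-mono-≤-< : ∀ {a b x y} → a ≤ b → x < y → a + x < b + y
  +-mono-≤-< {a} {b} {x} {y} a≤b x<y = begin-strict
    a + x     ≤⟨ +-monoˡ-≤ x a≤b ⟩
    b + x     <⟨ +-monoʳ-< b x<y ⟩
    b + y     ∎
    where open ≤-Reasoning

  x≤x+y : ∀ {x y} → 0# ≤ y → x ≤ x + y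
  x≤x+y {x} {y} 0≤y = subst (_≤ x + y) (+-identityʳ x) (+-monoʳ-≤ x 0≤y)

  x<x+y : ∀ {x y} → 0# < y → x < x + y
  x<x+y {x} {y} 0<y = subst (_< x + y) (+-identityʳ x) (+-monoʳ-< x 0<y)

  +-nonNeg : ∀ {x y} → 0# ≤ x → 0# ≤ y → 0# ≤ x + y
  +-nonNeg {x} 0≤x 0≤y = ≤-trans 0≤x (x≤x+y 0≤y)

  neg-mono-< : ∀ {x y} → x < y → - y < - x
  neg-mono-< {x} {y} x<y = subst₂ _<_ (solve 2 (λ x y → x :+ (:- x :+ :- y) := :- y) refl x y)
                                      (solve 2 (λ x y → y :+ (:- x :+ :- y) := :- x) refl x y)
                                      (+-mono-< (- x + - y) x<y)

  neg-mono-≤ : ∀ {x y} → x ≤ y → - y ≤ - x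
  neg-mono-≤ (inj₁ x<y) = inj₁ (neg-mono-< x<y)
  neg-mono-≤ (inj₂ refl) = inj₂ refl

  neg-pos : ∀ {x} → 0# < x → - x < 0#
  neg-pos 0<x = subst (_ <_) -0#≈0# (neg-mono-< 0<x)

  neg-nonPos : ∀ {x} → x ≤ 0# → 0# ≤ - x
  neg-nonPos x≤0 = subst (_≤ _) -0#≈0# (neg-mono-≤ x≤0)

  neg-nonNeg : ∀ {x} → 0# ≤ x → - x ≤ 0#
  neg-nonNeg 0≤x = subst (_ ≤_) -0#≈0# (neg-mono-≤ 0≤x)

  x-y≤x : ∀ {x y} → 0# ≤ y → x - y ≤ x
  x-y≤x {x} {y} 0≤y = subst (x - y ≤_) (+-identityʳ x) (+-monoʳ-≤ x (neg-nonNeg 0≤y))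

  x≤y⇒0≤y-x : ∀ {x y} → x ≤ y → 0# ≤ y - x
  x≤y⇒0≤y-x {x} {y} x≤y = subst (_≤ y - x) (-‿inverseʳ x) (+-monoˡ-≤ (- x) x≤y)

  x-y≡0⇒x≡y : ∀ {x y} → x - y ≡ 0# → x ≡ y
  x-y≡0⇒x≡y {x} {y} x-y≡0 = trans (solve 2 (λ x y → x := (x :- y) :+ y) refl x y) (trans (cong (_+ y) x-y≡0) (+-identityˡ y))

  0<1 : 0# < 1#
  0<1 with compare 0# 1#
  ... | tri< 0<1 _ _ = 0<1
  ... | tri≈ _ 0≡1 _ = ⊥-elim (0≢1 0≡1)
  ... | tri> _ _ 1<0 = ⊥-elim (<-asym 1<0 (subst (0# <_) square (*-pos 0<-1 0<-1)))
    where
    0<-1 : 0# < - 1#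
    0<-1 = subst (_< - 1#) -0#≈0# (neg-mono-< 1<0)
    square : - 1# * - 1# ≡ 1#
    square = trans (solve 1 (λ o → :- o :* :- o := o :* o) refl 1#) (*-identityʳ 1#)

  *-monoʳ-<-pos : ∀ {s x y} → 0# < s → x < y → s * x < s * y
  *-monoʳ-<-pos {s} {x} {y} 0<s x<y = subst₂ _<_ (+-identityˡ (s * x)) identity
    (+-mono-< (s * x) (*-pos 0<s (subst (_< y - x) (-‿inverseʳ x) (+-mono-< (- x) x<y))))
    where
    identity : s * (y - x) + s * x ≡ s * y
    identity = solve 3 (λ s x y → s :* (y :- x) :+ s :* x := s :* y) refl s x y

  *-monoʳ-≤-nonNeg : ∀ {s x y} → 0# ≤ s → x ≤ y → s * x ≤ s * y
  *-monoʳ-≤-nonNeg _ (inj₂ refl) = ≤-refl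
  *-monoʳ-≤-nonNeg (inj₁ 0<s) (inj₁ x<y) = inj₁ (*-monoʳ-<-pos 0<s x<y)
  *-monoʳ-≤-nonNeg {x = x} {y} (inj₂ refl) (inj₁ _) = inj₂ (trans (zeroˡ x) (sym (zeroˡ y)))

  *-nonNeg : ∀ {x y} → 0# ≤ x → 0# ≤ y → 0# ≤ x * y
  *-nonNeg {x} 0≤x 0≤y = subst (_≤ _) (zeroʳ x) (*-monoʳ-≤-nonNeg 0≤x 0≤y)

  pos⇒inverse : ∀ {x} → 0# < x → ∃ λ y → x * y ≡ 1# × 0# < y
  pos⇒inverse {x} 0<x with inverse x (λ x≡0 → <-irrefl (sym x≡0) 0<x)
  ... | y , xy≡1 with compare 0# y
  ...   | tri< 0<y _ _ = y , xy≡1 , 0<y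
  ...   | tri≈ _ refl _ = ⊥-elim (0≢1 (trans (sym (zeroʳ x)) xy≡1))
  ...   | tri> _ _ y<0 = ⊥-elim (<-asym 0<1 (subst (_< 0#) xy≡1 negative))
    where
    negative : x * y < 0#
    negative = subst₂ _<_ (solve 2 (λ x y → :- (x :* :- y) := x :* y) refl x y) -0#≈0#
                 (neg-mono-< (*-pos 0<x (subst (_< - y) -0#≈0# (neg-mono-< y<0))))

  sum-cong : ∀ {n} {f g : Fin n → Carrier} → (∀ i → f i ≡ g i) → sum f ≡ sum g
  sum-cong {zero} f≗g = refl
  sum-cong {suc n} f≗g = cong₂ _+_ (f≗g zero) (sum-cong (f≗g ∘ suc))

  sum-0 : ∀ n → sum {n} (λ _ → 0#) ≡ 0#
  sum-0 zero = refl
  sum-0 (suc n) = trans (cong (0# +_) (sum-0 n)) (+-identityʳ 0#)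

  sum-+ : ∀ {n} (f g : Fin n → Carrier) → sum (λ i → f i + g i) ≡ sum f + sum g
  sum-+ {zero} f g = sym (+-identityʳ 0#)
  sum-+ {suc n} f g = trans (cong (f zero + g zero +_) (sum-+ (f ∘ suc) (g ∘ suc))) (interchange _ _ _ _)

  sum-neg : ∀ {n} (f : Fin n → Carrier) → sum (λ i → - f i) ≡ - sum f
  sum-neg {zero} f = sym -0#≈0#
  sum-neg {suc n} f = trans (cong (- f zero +_) (sum-neg (f ∘ suc))) (⁻¹-∙-comm _ _)

  sum-- : ∀ {n} (f g : Fin n → Carrier) → sum (λ i → f i - g i) ≡ sum f - sum g
  sum-- f g = trans (sum-+ f (λ i → - g i)) (cong (sum f +_) (sum-neg g))

  sum-*ˡ : ∀ {n} c (f : Fin n → Carrier) → sum (λ i → c * f i) ≡ c * sum f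
  sum-*ˡ {zero} c f = sym (zeroʳ c)
  sum-*ˡ {suc n} c f = trans (cong (c * f zero +_) (sum-*ˡ c (f ∘ suc))) (sym (distribˡ _ _ _))

  sum-*ʳ : ∀ {n} c (f : Fin n → Carrier) → sum (λ i → f i * c) ≡ sum f * c
  sum-*ʳ c f = trans (sum-cong (λ i → *-comm (f i) c)) (trans (sum-*ˡ c f) (*-comm c _))

  sum-comm : ∀ {m n} (f : Fin m → Fin n → Carrier) → sum (λ i → sum (f i)) ≡ sum (λ j → sum (λ i → f i j))
  sum-comm {zero} {n} f = sym (sum-0 n)
  sum-comm {suc m} f = trans (cong (sum (f zero) +_) (sum-comm (f ∘ suc)))
                             (sym (sum-+ (f zero) (λ j → sum (λ i → f (suc i) j))))

  sum-nonNeg : ∀ {n} {f : Fin n → Carrier} → (∀ i → 0# ≤ f i) → 0# ≤ sum f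
  sum-nonNeg {zero} _ = ≤-refl
  sum-nonNeg {suc n} 0≤f = +-nonNeg (0≤f zero) (sum-nonNeg (0≤f ∘ suc))

  sum-mono-≤ : ∀ {n} {f g : Fin n → Carrier} → (∀ i → f i ≤ g i) → sum f ≤ sum g
  sum-mono-≤ {zero} _ = ≤-refl
  sum-mono-≤ {suc n} f≤g = +-mono-≤ (f≤g zero) (sum-mono-≤ (f≤g ∘ suc))

  sum-tail≤sum : ∀ {n} {f : Fin (suc n) → Carrier} → 0# ≤ f zero → sum (f ∘ suc) ≤ sum f
  sum-tail≤sum {f = f} 0≤f₀ = subst (_≤ sum f) (+-identityˡ _) (+-monoˡ-≤ _ 0≤f₀)

  term≤sum : ∀ {n} {f : Fin n → Carrier} → (∀ i → 0# ≤ f i) → ∀ j → f j ≤ sum f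
  term≤sum 0≤f zero = x≤x+y (sum-nonNeg (0≤f ∘ suc))
  term≤sum {f = f} 0≤f (suc j) = ≤-trans (term≤sum (0≤f ∘ suc) j) (sum-tail≤sum {f = f} (0≤f zero))

  two-terms≤sum : ∀ {n} {f : Fin n → Carrier} → (∀ i → 0# ≤ f i) → ∀ {j k} → j ≢ k → f j + f k ≤ sum f
  two-terms≤sum 0≤f {zero} {zero} 0≢0 = ⊥-elim (0≢0 refl)
  two-terms≤sum 0≤f {zero} {suc k} _ = +-monoʳ-≤ _ (term≤sum (0≤f ∘ suc) k)
  two-terms≤sum {f = f} 0≤f {suc j} {zero} _ =
    subst (_≤ sum f) (+-comm (f zero) _) (+-monoʳ-≤ _ (term≤sum (0≤f ∘ suc) j))
  two-terms≤sum {f = f} 0≤f {suc j} {suc k} j≢k =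
    ≤-trans (two-terms≤sum (0≤f ∘ suc) (j≢k ∘ cong suc)) (sum-tail≤sum {f = f} (0≤f zero))

  δ : ∀ {n} → Fin n → Fin n → Carrier
  δ zero zero = 1#
  δ zero (suc _) = 0#
  δ (suc _) zero = 0#
  δ (suc i) (suc k) = δ i k

  δ-diag : ∀ {n} (i : Fin n) → δ i i ≡ 1#
  δ-diag zero = refl
  δ-diag (suc i) = δ-diag i

  δ-offdiag : ∀ {n} {i k : Fin n} → i ≢ k → δ i k ≡ 0#
  δ-offdiag {i = zero} {zero} 0≢0 = ⊥-elim (0≢0 refl)
  δ-offdiag {i = zero} {suc k} _ = refl
  δ-offdiag {i = suc i} {zero} _ = refl
  δ-offdiag {i = suc i} {suc k} i≢k = δ-offdiag (i≢k ∘ cong suc)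

  δ-nonNeg : ∀ {n} (i k : Fin n) → 0# ≤ δ i k
  δ-nonNeg zero zero = inj₁ 0<1
  δ-nonNeg zero (suc _) = ≤-refl
  δ-nonNeg (suc _) zero = ≤-refl
  δ-nonNeg (suc i) (suc k) = δ-nonNeg i k

  sum-δ* : ∀ {n} (j : Fin n) (f : Fin n → Carrier) → sum (λ k → δ j k * f k) ≡ f j
  sum-δ* {suc n} zero f =
    trans (cong₂ _+_ (*-identityˡ (f zero)) (trans (sum-cong λ k → zeroˡ (f (suc k))) (sum-0 n))) (+-identityʳ _)
  sum-δ* {suc n} (suc j) f = trans (cong₂ _+_ (zeroˡ (f zero)) (sum-δ* j (f ∘ suc))) (+-identityˡ _)

  sum-δ : ∀ {n} (j : Fin n) → sum (δ j) ≡ 1#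
  sum-δ j = trans (sum-cong λ k → sym (*-identityʳ (δ j k))) (sum-δ* j (λ _ → 1#))

  sum-δ-δ : ∀ {n} (i j : Fin n) → sum (λ k → δ i k - δ j k) ≡ 0#
  sum-δ-δ i j = trans (sum-- (δ i) (δ j)) (trans (cong₂ _-_ (sum-δ i) (sum-δ j)) (-‿inverseʳ 1#))

  argmax : ∀ {n} → Fin n → (g : Fin n → Carrier) → ∃ λ j → ∀ k → g k ≤ g j
  argmax {suc zero} _ g = zero , λ { zero → ≤-refl }
  argmax {suc (suc n)} _ g with argmax zero (g ∘ suc)
  ... | j , g∘suc≤ with ≤-total (g zero) (g (suc j))
  ...   | inj₁ g₀≤ = suc j , λ { zero → g₀≤ ; (suc k) → g∘suc≤ k }
  ...   | inj₂ ≥g₀ = zero , λ { zero → ≤-refl ; (suc k) → ≤-trans (g∘suc≤ k) ≥g₀ }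

  convex-max : ∀ {n} {μ g : Fin n → Carrier} → (∀ j → 0# ≤ μ j) → sum μ ≡ 1# →
               (∀ j → g j ≤ 1#) → sum (λ j → μ j * g j) ≡ 1# → ∃ λ j → g j ≡ 1#
  convex-max {zero} _ Σμ≡1 _ _ = ⊥-elim (0≢1 Σμ≡1)
  convex-max {suc n} {μ} {g} 0≤μ Σμ≡1 g≤1 Σμg≡1 with argmax zero g
  ... | j , g≤gj = j , ≤-antisym (g≤1 j) 1≤gj
    where
    open ≤-Reasoning
    1≤gj : 1# ≤ g j
    1≤gj = begin
      1#                       ≡⟨ Σμg≡1 ⟨
      sum (λ k → μ k * g k)    ≤⟨ sum-mono-≤ (λ k → *-monoʳ-≤-nonNeg (0≤μ k) (g≤gj k)) ⟩
      sum (λ k → μ k * g j)    ≡⟨ sum-*ʳ (g j) μ ⟩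
      sum μ * g j              ≡⟨ trans (cong (_* g j) Σμ≡1) (*-identityˡ (g j)) ⟩
      g j                      ∎

  convex-extreme : ∀ {n} {μ L s : Fin n → Carrier} → (∀ j → 0# ≤ μ j) → sum μ ≡ 1# →
                   (∀ j → L j ≤ 1#) → (∀ j → 0# ≤ s j) →
                   sum (λ j → μ j * L j) ≡ 1# → sum (λ j → μ j * s j) ≡ 0# →
                   ∃ λ j → L j ≡ 1# × s j ≡ 0#
  convex-extreme {μ = μ} {L} {s} 0≤μ Σμ≡1 L≤1 0≤s ΣμL≡1 Σμs≡0
    with convex-max {g = λ j → L j - s j} 0≤μ Σμ≡1 (λ j → ≤-trans (x-y≤x (0≤s j)) (L≤1 j)) Σμ[L-s]≡1
    where
    Σμ[L-s]≡1 : sum (λ j → μ j * (L j - s j)) ≡ 1#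
    Σμ[L-s]≡1 = begin
      sum (λ j → μ j * (L j - s j))                          ≡⟨ sum-cong (λ j → solve 3 (λ m l t → m :* (l :- t) := m :* l :- m :* t) refl (μ j) (L j) (s j)) ⟩
      sum (λ j → (μ j * L j) - (μ j * s j))                  ≡⟨ sum-- (λ j → μ j * L j) (λ j → μ j * s j) ⟩
      sum (λ j → μ j * L j) - sum (λ j → μ j * s j)          ≡⟨ cong₂ _-_ ΣμL≡1 Σμs≡0 ⟩
      1# - 0#                                                ≡⟨ cong (1# +_) -0#≈0# ⟩
      1# + 0#                                                ≡⟨ +-identityʳ 1# ⟩
      1#                                                     ∎
      where open ≡-Reasoning
  ... | j , Lj-sj≡1 = j , Lj≡1 , sj≡0
    where
    Lj≡1 : L j ≡ 1#
    Lj≡1 = ≤-antisym (L≤1 j) (subst (_≤ L j) Lj-sj≡1 (x-y≤x (0≤s j)))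
    sj≡0 : s j ≡ 0#
    sj≡0 = begin
      s j                    ≡⟨ solve 2 (λ l t → t := l :- (l :- t)) refl (L j) (s j) ⟩
      L j - (L j - s j)      ≡⟨ cong₂ _-_ Lj≡1 Lj-sj≡1 ⟩
      1# - 1#                ≡⟨ -‿inverseʳ 1# ⟩
      0#                     ∎
      where open ≡-Reasoning

  unit-vector : ∀ {n} {L : Fin n → Carrier} → (∀ k → 0# ≤ L k) → sum L ≡ 1# →
                ∀ {i} → L i ≡ 1# → ∀ k → L k ≡ δ i k
  unit-vector {L = L} 0≤L ΣL≡1 {i} Li≡1 k with i Fin.≟ k
  ... | yes refl = trans Li≡1 (sym (δ-diag i))
  ... | no i≢k = trans (≤-antisym Lk≤0 (0≤L k)) (sym (δ-offdiag i≢k))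
    where
    Lk≤0 : L k ≤ 0#
    Lk≤0 = subst₂ _≤_ (solve 2 (λ o x → (o :+ x) :- o := x) refl 1# (L k)) (-‿inverseʳ 1#)
             (+-monoˡ-≤ (- 1#) (subst₂ _≤_ (cong (_+ L k) Li≡1) ΣL≡1 (two-terms≤sum 0≤L i≢k)))

  lookup-ext : ∀ {d} {p q : Point d} → (∀ i → lookup p i ≡ lookup q i) → p ≡ q
  lookup-ext {p = p} {q} p≗q = trans (sym (Vec.tabulate∘lookup p)) (trans (Vec.tabulate-cong p≗q) (Vec.tabulate∘lookup q))

  lookup-+ᵥ : ∀ {d} (p q : Point d) i → lookup (p +ᵥ q) i ≡ lookup p i + lookup q i
  lookup-+ᵥ p q i = Vec.lookup-zipWith _+_ i p q

  lookup-·ᵥ : ∀ {d} c (p : Point d) i → lookup (c ·ᵥ p) i ≡ c * lookup p i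
  lookup-·ᵥ c p i = Vec.lookup-map i (c *_) p

  lookup-vsum : ∀ {n d} (f : Fin n → Point d) i → lookup (vsum f) i ≡ sum (λ k → lookup (f k) i)
  lookup-vsum {zero} f i = Vec.lookup-replicate i 0#
  lookup-vsum {suc n} f i = trans (lookup-+ᵥ (f zero) (vsum (f ∘ suc)) i) (cong (lookup (f zero) i +_) (lookup-vsum (f ∘ suc) i))

  vsum-cong : ∀ {n d} {f g : Fin n → Point d} → (∀ i → f i ≡ g i) → vsum f ≡ vsum g
  vsum-cong {zero} f≗g = refl
  vsum-cong {suc n} f≗g = cong₂ _+ᵥ_ (f≗g zero) (vsum-cong (f≗g ∘ suc))

  vsum-δ : ∀ {n d} (j : Fin n) (f : Fin n → Point d) → vsum (λ k → δ j k ·ᵥ f k) ≡ f j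
  vsum-δ j f = lookup-ext λ m →
    trans (lookup-vsum (λ k → δ j k ·ᵥ f k) m) (trans (sum-cong λ k → lookup-·ᵥ (δ j k) (f k) m) (sum-δ* j (λ k → lookup (f k) m)))

  +ᵥ-assoc : ∀ {d} (p q r : Point d) → (p +ᵥ q) +ᵥ r ≡ p +ᵥ (q +ᵥ r)
  +ᵥ-assoc = Vec.zipWith-assoc +-assoc

  +ᵥ-cancelʳ : ∀ {d} {p q : Point d} r → p +ᵥ r ≡ q +ᵥ r → p ≡ q
  +ᵥ-cancelʳ {p = p} {q} r p+r≡q+r = lookup-ext λ i →
    ∙-cancelʳ (lookup r i) _ _ (trans (sym (lookup-+ᵥ p r i)) (trans (cong (λ z → lookup z i) p+r≡q+r) (lookup-+ᵥ q r i)))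

  ∣_∣ : Carrier → Carrier
  ∣ x ∣ = [ (λ _ → x) , (λ _ → - x) ]′ (≤-total 0# x)

  ∣x∣-bounds : ∀ x → 0# ≤ ∣ x ∣ × x ≤ ∣ x ∣ × - x ≤ ∣ x ∣
  ∣x∣-bounds x with ≤-total 0# x
  ... | inj₁ 0≤x = 0≤x , ≤-refl , ≤-trans (neg-nonNeg 0≤x) 0≤x
  ... | inj₂ x≤0 = neg-nonPos x≤0 , ≤-trans x≤0 (neg-nonPos x≤0) , ≤-refl

  shrink-into-cube : ∀ {d ε} → 0# < ε → (e : Point d) →
                     ∃ λ s → 0# < s × (∀ i → - ε < s * lookup e i × s * lookup e i < ε)
  shrink-into-cube {ε = ε} 0<ε e = scale (pos⇒inverse 0<M)
    where
    M : Carrier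
    M = sum (λ i → ∣ lookup e i ∣) + 1#
    0<M : 0# < M
    0<M = begin-strict
      0#                               ≤⟨ sum-nonNeg (λ i → proj₁ (∣x∣-bounds (lookup e i))) ⟩
      sum (λ i → ∣ lookup e i ∣)        <⟨ x<x+y 0<1 ⟩
      M                                ∎
      where open ≤-Reasoning
    scale : (∃ λ y → M * y ≡ 1# × 0# < y) → ∃ λ s → 0# < s × (∀ i → - ε < s * lookup e i × s * lookup e i < ε)
    scale (y , My≡1 , 0<y) = s , 0<s , λ i → below i , above i
      where
      s : Carrier
      s = ε * y
      0<s : 0# < s
      0<s = *-pos 0<ε 0<y
      bounded : ∀ {x} i → x ≤ ∣ lookup e i ∣ → s * x < ε
      bounded {x} i x≤ = begin-strict
        s * x                             ≤⟨ *-monoʳ-≤-nonNeg (inj₁ 0<s) (≤-trans x≤ (term≤sum (λ j → proj₁ (∣x∣-bounds (lookup e j))) i)) ⟩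
        s * sum (λ j → ∣ lookup e j ∣)     <⟨ *-monoʳ-<-pos 0<s (x<x+y 0<1) ⟩
        s * M                             ≡⟨ solve 3 (λ ε y m → (ε :* y) :* m := ε :* (m :* y)) refl ε y M ⟩
        ε * (M * y)                       ≡⟨ trans (cong (ε *_) My≡1) (*-identityʳ ε) ⟩
        ε                                 ∎
        where open ≤-Reasoning
      above : ∀ i → s * lookup e i < ε
      above i = bounded i (proj₁ (proj₂ (∣x∣-bounds (lookup e i))))
      below : ∀ i → - ε < s * lookup e i
      below i = subst (- ε <_) (solve 2 (λ a b → :- (a :* :- b) := a :* b) refl s (lookup e i))
                  (neg-mono-< (bounded i (proj₂ (proj₂ (∣x∣-bounds (lookup e i))))))

  module Prism {d} (B : List (Point d)) {v w : Fin d → Point d} {u : Point d} {t : Fin d → Carrier}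
    (independent : ∀ (ℓ : Fin d → Carrier) h → sum ℓ ≡ 0# →
                   vsum (λ i → ℓ i ·ᵥ v i) +ᵥ (h ·ᵥ u) ≡ 0ᵥ → h ≡ 0# × (∀ i → ℓ i ≡ 0#))
    (0<t : ∀ i → 0# < t i)
    (w≡v+tu : ∀ i → w i ≡ v i +ᵥ (t i ·ᵥ u))
    (hull⇔prism : ∀ y → (InHull B y → InConv2 v w y) × (InConv2 v w y → InHull B y))
    where

    point : (Fin d → Carrier) → Carrier → Point d
    point ℓ h = vsum (λ k → ℓ k ·ᵥ v k) +ᵥ (h ·ᵥ u)

    lookup-point : ∀ (ℓ : Fin d → Carrier) h m → lookup (point ℓ h) m ≡ sum (λ k → ℓ k * lookup (v k) m) + h * lookup u m
    lookup-point ℓ h m = trans (lookup-+ᵥ (vsum (λ k → ℓ k ·ᵥ v k)) (h ·ᵥ u) m)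
      (cong₂ _+_ (trans (lookup-vsum (λ k → ℓ k ·ᵥ v k) m) (sum-cong λ k → lookup-·ᵥ (ℓ k) (v k) m)) (lookup-·ᵥ h u m))

    point-cong : ∀ {ℓ ℓ′ : Fin d → Carrier} {h h′} → (∀ k → ℓ k ≡ ℓ′ k) → h ≡ h′ → point ℓ h ≡ point ℓ′ h′
    point-cong {ℓ} {ℓ′} {h} ℓ≗ℓ′ refl = lookup-ext λ m →
      trans (lookup-point ℓ h m) (trans (cong (_+ h * lookup u m) (sum-cong λ k → cong (_* lookup (v k) m) (ℓ≗ℓ′ k)))
                                        (sym (lookup-point ℓ′ h m)))

    point-+ᵥ : ∀ (ℓ : Fin d → Carrier) h (ℓ′ : Fin d → Carrier) h′ → point ℓ h +ᵥ point ℓ′ h′ ≡ point (λ k → ℓ k + ℓ′ k) (h + h′)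
    point-+ᵥ ℓ h ℓ′ h′ = lookup-ext λ m → begin
      lookup (point ℓ h +ᵥ point ℓ′ h′) m
        ≡⟨ trans (lookup-+ᵥ (point ℓ h) (point ℓ′ h′) m) (cong₂ _+_ (lookup-point ℓ h m) (lookup-point ℓ′ h′ m)) ⟩
      (Σℓv m + h * lookup u m) + (Σℓ′v m + h′ * lookup u m)
        ≡⟨ solve 5 (λ a b x y U → (a :+ x :* U) :+ (b :+ y :* U) := (a :+ b) :+ (x :+ y) :* U) refl (Σℓv m) (Σℓ′v m) h h′ (lookup u m) ⟩
      (Σℓv m + Σℓ′v m) + (h + h′) * lookup u m
        ≡⟨ cong (_+ (h + h′) * lookup u m) (trans (sym (sum-+ (λ k → ℓ k * lookup (v k) m) (λ k → ℓ′ k * lookup (v k) m)))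
                                                  (sum-cong λ k → sym (distribʳ (lookup (v k) m) (ℓ k) (ℓ′ k)))) ⟩
      sum (λ k → (ℓ k + ℓ′ k) * lookup (v k) m) + (h + h′) * lookup u m
        ≡⟨ lookup-point (λ k → ℓ k + ℓ′ k) (h + h′) m ⟨
      lookup (point (λ k → ℓ k + ℓ′ k) (h + h′)) m ∎
      where
      open ≡-Reasoning
      Σℓv Σℓ′v : Fin d → Carrier
      Σℓv m = sum (λ k → ℓ k * lookup (v k) m)
      Σℓ′v m = sum (λ k → ℓ′ k * lookup (v k) m)

    vsum-point : ∀ {n} (μ : Fin n → Carrier) (ℓ : Fin n → Fin d → Carrier) (h : Fin n → Carrier) →
                 vsum (λ j → μ j ·ᵥ point (ℓ j) (h j)) ≡ point (λ k → sum (λ j → μ j * ℓ j k)) (sum (λ j → μ j * h j))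
    vsum-point μ ℓ h = lookup-ext λ m → begin
      lookup (vsum (λ j → μ j ·ᵥ point (ℓ j) (h j))) m
        ≡⟨ trans (lookup-vsum (λ j → μ j ·ᵥ point (ℓ j) (h j)) m)
                 (sum-cong λ j → trans (lookup-·ᵥ (μ j) (point (ℓ j) (h j)) m) (cong (μ j *_) (lookup-point (ℓ j) (h j) m))) ⟩
      sum (λ j → μ j * (sum (λ k → ℓ j k * lookup (v k) m) + h j * lookup u m))
        ≡⟨ sum-cong (λ j → trans (distribˡ (μ j) (sum (λ k → ℓ j k * lookup (v k) m)) (h j * lookup u m))
                                 (cong₂ _+_ (sym (sum-*ˡ (μ j) (λ k → ℓ j k * lookup (v k) m))) (sym (*-assoc (μ j) (h j) (lookup u m))))) ⟩
      sum (λ j → sum (λ k → μ j * (ℓ j k * lookup (v k) m)) + μ j * h j * lookup u m)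
        ≡⟨ sum-+ (λ j → sum (λ k → μ j * (ℓ j k * lookup (v k) m))) (λ j → μ j * h j * lookup u m) ⟩
      sum (λ j → sum (λ k → μ j * (ℓ j k * lookup (v k) m))) + sum (λ j → μ j * h j * lookup u m)
        ≡⟨ cong₂ _+_ (trans (sum-comm (λ j k → μ j * (ℓ j k * lookup (v k) m)))
                            (sum-cong λ k → trans (sum-cong λ j → sym (*-assoc (μ j) (ℓ j k) (lookup (v k) m)))
                                                  (sum-*ʳ (lookup (v k) m) (λ j → μ j * ℓ j k))))
                     (sum-*ʳ (lookup u m) (λ j → μ j * h j)) ⟩
      sum (λ k → sum (λ j → μ j * ℓ j k) * lookup (v k) m) + sum (λ j → μ j * h j) * lookup u m
        ≡⟨ lookup-point (λ k → sum (λ j → μ j * ℓ j k)) (sum (λ j → μ j * h j)) m ⟨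
      lookup (point (λ k → sum (λ j → μ j * ℓ j k)) (sum (λ j → μ j * h j))) m ∎
      where open ≡-Reasoning

    point-·ᵥ : ∀ c (ℓ : Fin d → Carrier) h → c ·ᵥ point ℓ h ≡ point (λ k → c * ℓ k) (c * h)
    point-·ᵥ c ℓ h = begin
      c ·ᵥ point ℓ h                                     ≡⟨ Vec.zipWith-identityʳ +-identityʳ (c ·ᵥ point ℓ h) ⟨
      vsum {1} (λ _ → c ·ᵥ point ℓ h)                    ≡⟨ vsum-point {1} (λ _ → c) (λ _ → ℓ) (λ _ → h) ⟩
      point (λ k → c * ℓ k + 0#) (c * h + 0#)            ≡⟨ point-cong (λ k → +-identityʳ (c * ℓ k)) (+-identityʳ (c * h)) ⟩
      point (λ k → c * ℓ k) (c * h)                      ∎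
      where open ≡-Reasoning

    lookup-point-− : ∀ (ℓ ℓ′ : Fin d → Carrier) h h′ m →
      lookup (point (λ k → ℓ k - ℓ′ k) (h - h′)) m ≡ lookup (point ℓ h) m - lookup (point ℓ′ h′) m
    lookup-point-− ℓ ℓ′ h h′ m = begin
      lookup (point (λ k → ℓ k - ℓ′ k) (h - h′)) m
        ≡⟨ lookup-point (λ k → ℓ k - ℓ′ k) (h - h′) m ⟩
      sum (λ k → (ℓ k - ℓ′ k) * lookup (v k) m) + (h - h′) * lookup u m
        ≡⟨ cong (_+ (h - h′) * lookup u m)
             (trans (sum-cong λ k → solve 3 (λ a b x → (a :- b) :* x := a :* x :- b :* x) refl (ℓ k) (ℓ′ k) (lookup (v k) m))
                    (sum-- (λ k → ℓ k * lookup (v k) m) (λ k → ℓ′ k * lookup (v k) m))) ⟩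
      (Σℓv - Σℓ′v) + (h - h′) * lookup u m
        ≡⟨ solve 5 (λ a b x y U → (a :- b) :+ (x :- y) :* U := (a :+ x :* U) :- (b :+ y :* U)) refl Σℓv Σℓ′v h h′ (lookup u m) ⟩
      (Σℓv + h * lookup u m) - (Σℓ′v + h′ * lookup u m)
        ≡⟨ cong₂ _-_ (lookup-point ℓ h m) (lookup-point ℓ′ h′ m) ⟨
      lookup (point ℓ h) m - lookup (point ℓ′ h′) m ∎
      where
      open ≡-Reasoning
      Σℓv Σℓ′v : Carrier
      Σℓv = sum (λ k → ℓ k * lookup (v k) m)
      Σℓ′v = sum (λ k → ℓ′ k * lookup (v k) m)

    point-injective : ∀ {ℓ ℓ′ : Fin d → Carrier} {h h′} → sum ℓ ≡ sum ℓ′ → point ℓ h ≡ point ℓ′ h′ →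
                      h ≡ h′ × (∀ k → ℓ k ≡ ℓ′ k)
    point-injective {ℓ} {ℓ′} {h} {h′} Σℓ≡Σℓ′ p≡p′ =
      x-y≡0⇒x≡y (proj₁ differences≡0) , x-y≡0⇒x≡y ∘ proj₂ differences≡0
      where
      differences≡0 : h - h′ ≡ 0# × (∀ k → ℓ k - ℓ′ k ≡ 0#)
      differences≡0 = independent (λ k → ℓ k - ℓ′ k) (h - h′)
        (trans (sum-- ℓ ℓ′) (trans (cong (_- sum ℓ′) Σℓ≡Σℓ′) (-‿inverseʳ (sum ℓ′))))
        (lookup-ext λ m → trans (lookup-point-− ℓ ℓ′ h h′ m)
                            (trans (cong (λ p → lookup p m - lookup (point ℓ′ h′) m) p≡p′)
                                   (trans (-‿inverseʳ (lookup (point ℓ′ h′) m)) (sym (Vec.lookup-replicate m 0#)))))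

    conv2≡point : ∀ (α β : Fin d → Carrier) →
      vsum (λ i → α i ·ᵥ v i) +ᵥ vsum (λ i → β i ·ᵥ w i) ≡ point (λ k → α k + β k) (sum (λ k → β k * t k))
    conv2≡point α β = lookup-ext λ m → begin
      lookup (vsum (λ i → α i ·ᵥ v i) +ᵥ vsum (λ i → β i ·ᵥ w i)) m
        ≡⟨ trans (lookup-+ᵥ (vsum (λ i → α i ·ᵥ v i)) (vsum (λ i → β i ·ᵥ w i)) m)
             (cong₂ _+_ (trans (lookup-vsum (λ i → α i ·ᵥ v i) m) (sum-cong λ k → lookup-·ᵥ (α k) (v k) m))
                        (trans (lookup-vsum (λ i → β i ·ᵥ w i) m) (sum-cong λ k → trans (lookup-·ᵥ (β k) (w k) m) (cong (β k *_) (lookup-w k m))))) ⟩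
      sum (λ k → α k * lookup (v k) m) + sum (λ k → β k * (lookup (v k) m + t k * lookup u m))
        ≡⟨ sum-+ (λ k → α k * lookup (v k) m) (λ k → β k * (lookup (v k) m + t k * lookup u m)) ⟨
      sum (λ k → α k * lookup (v k) m + β k * (lookup (v k) m + t k * lookup u m))
        ≡⟨ sum-cong (λ k → solve 5 (λ a b x T U → a :* x :+ b :* (x :+ T :* U) := (a :+ b) :* x :+ (b :* T) :* U)
                                   refl (α k) (β k) (lookup (v k) m) (t k) (lookup u m)) ⟩
      sum (λ k → (α k + β k) * lookup (v k) m + (β k * t k) * lookup u m)
        ≡⟨ trans (sum-+ (λ k → (α k + β k) * lookup (v k) m) (λ k → (β k * t k) * lookup u m))
                 (cong (sum (λ k → (α k + β k) * lookup (v k) m) +_) (sum-*ʳ (lookup u m) (λ k → β k * t k))) ⟩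
      sum (λ k → (α k + β k) * lookup (v k) m) + sum (λ k → β k * t k) * lookup u m
        ≡⟨ lookup-point (λ k → α k + β k) (sum (λ k → β k * t k)) m ⟨
      lookup (point (λ k → α k + β k) (sum (λ k → β k * t k))) m ∎
      where
      open ≡-Reasoning
      lookup-w : ∀ k m → lookup (w k) m ≡ lookup (v k) m + t k * lookup u m
      lookup-w k m = trans (cong (λ p → lookup p m) (w≡v+tu k))
                           (trans (lookup-+ᵥ (v k) (t k ·ᵥ u) m) (cong (lookup (v k) m +_) (lookup-·ᵥ (t k) u m)))

    record Coordinates (y : Point d) : Set where
      field
        ℓ : Fin d → Carrier
        h : Carrier
        0≤ℓ : ∀ k → 0# ≤ ℓ k
        Σℓ≡1 : sum ℓ ≡ 1#
        0≤h : 0# ≤ h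
        h≤Σℓt : h ≤ sum (λ k → ℓ k * t k)
        y≡point : y ≡ point ℓ h

    open Coordinates

    coordinates : ∀ {y} → InHull B y → Coordinates y
    coordinates {y} y∈[B] with proj₁ (hull⇔prism y) y∈[B]
    ... | α , β , 0≤α , 0≤β , Σα+Σβ≡1 , y≡ = record
      { ℓ = λ k → α k + β k
      ; h = sum (λ k → β k * t k)
      ; 0≤ℓ = λ k → +-nonNeg (0≤α k) (0≤β k)
      ; Σℓ≡1 = trans (sum-+ α β) Σα+Σβ≡1
      ; 0≤h = sum-nonNeg (λ k → *-nonNeg (0≤β k) (inj₁ (0<t k)))
      ; h≤Σℓt = sum-mono-≤ λ k → subst (β k * t k ≤_) (trans (+-comm (β k * t k) (α k * t k)) (sym (distribʳ (t k) (α k) (β k))))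
                                        (x≤x+y (*-nonNeg (0≤α k) (inj₁ (0<t k))))
      ; y≡point = trans y≡ (conv2≡point α β)
      }

    ℓ≤1 : ∀ {y} (cy : Coordinates y) k → ℓ cy k ≤ 1#
    ℓ≤1 cy k = subst (ℓ cy k ≤_) (Σℓ≡1 cy) (term≤sum (0≤ℓ cy) k)

    h≤max : ∀ {y} (cy : Coordinates y) {T} → (∀ k → t k ≤ T) → h cy ≤ T
    h≤max cy {T} t≤T = begin
      h cy                        ≤⟨ h≤Σℓt cy ⟩
      sum (λ k → ℓ cy k * t k)    ≤⟨ sum-mono-≤ (λ k → *-monoʳ-≤-nonNeg (0≤ℓ cy k) (t≤T k)) ⟩
      sum (λ k → ℓ cy k * T)      ≡⟨ trans (sum-*ʳ T (ℓ cy)) (trans (cong (_* T) (Σℓ≡1 cy)) (*-identityˡ T)) ⟩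
      T                           ∎
      where open ≤-Reasoning

    interior⇒hull : ∀ {y} → InInterior B y → InHull B y
    interior⇒hull {y} (ε , 0<ε , cube) =
      cube y λ i → subst (λ r → - ε < r × r < ε) (sym (-‿inverseʳ (lookup y i))) (neg-pos 0<ε , 0<ε)

    interior-step : ∀ {y} → InInterior B y → (e : Point d) → ∃ λ s → 0# < s × InHull B (y +ᵥ (s ·ᵥ e))
    interior-step {y} (ε , 0<ε , cube) e = map₂ (map₂ inside) (shrink-into-cube 0<ε e)
      where
      displacement : ∀ s i → lookup (y +ᵥ (s ·ᵥ e)) i - lookup y i ≡ s * lookup e i
      displacement s i = trans (cong (_- lookup y i) (trans (lookup-+ᵥ y (s ·ᵥ e) i) (cong (lookup y i +_) (lookup-·ᵥ s e i))))
                               (solve 2 (λ a b → (a :+ b) :- a := b) refl (lookup y i) (s * lookup e i))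
      inside : ∀ {s} → (∀ i → - ε < s * lookup e i × s * lookup e i < ε) → InHull B (y +ᵥ (s ·ᵥ e))
      inside {s} small = cube (y +ᵥ (s ·ᵥ e)) λ i → subst (λ r → - ε < r × r < ε) (sym (displacement s i)) (small i)

    interior-perturb : ∀ {y} → InInterior B y → (cy : Coordinates y) → ∀ (ℓ′ : Fin d → Carrier) h′ → sum ℓ′ ≡ 0# →
      ∃ λ s → 0# < s × 0# ≤ h cy + s * h′ × (∀ k → ℓ cy k + s * ℓ′ k ≤ 1#)
    interior-perturb {y} y° cy ℓ′ h′ Σℓ′≡0 = map₂ (map₂ bounds) (interior-step y° (point ℓ′ h′))
      where
      bounds : ∀ {s} → InHull B (y +ᵥ (s ·ᵥ point ℓ′ h′)) → 0# ≤ h cy + s * h′ × (∀ k → ℓ cy k + s * ℓ′ k ≤ 1#)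
      bounds {s} z∈[B] = subst (0# ≤_) (proj₁ agree) (0≤h cz) , λ k → subst (_≤ 1#) (proj₂ agree k) (ℓ≤1 cz k)
        where
        cz : Coordinates (y +ᵥ (s ·ᵥ point ℓ′ h′))
        cz = coordinates z∈[B]
        Σℓ-agree : sum (ℓ cz) ≡ sum (λ k → ℓ cy k + s * ℓ′ k)
        Σℓ-agree = trans (Σℓ≡1 cz) (sym (trans (sum-+ (ℓ cy) (λ k → s * ℓ′ k))
                     (trans (cong₂ _+_ (Σℓ≡1 cy) (trans (sum-*ˡ s ℓ′) (trans (cong (s *_) Σℓ′≡0) (zeroʳ s)))) (+-identityʳ 1#))))
        z≡point : y +ᵥ (s ·ᵥ point ℓ′ h′) ≡ point (λ k → ℓ cy k + s * ℓ′ k) (h cy + s * h′)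
        z≡point = trans (cong₂ _+ᵥ_ (y≡point cy) (point-·ᵥ s ℓ′ h′)) (point-+ᵥ (ℓ cy) (h cy) (λ k → s * ℓ′ k) (s * h′))
        agree : h cz ≡ h cy + s * h′ × (∀ k → ℓ cz k ≡ ℓ cy k + s * ℓ′ k)
        agree = point-injective Σℓ-agree (trans (sym (y≡point cz)) z≡point)

    interior⇒0<h : ∀ {y} → InInterior B y → (cy : Coordinates y) → 0# < h cy
    interior⇒0<h y° cy = lower (interior-perturb y° cy (λ _ → 0#) (- 1#) (sum-0 d))
      where
      lower : (∃ λ s → 0# < s × 0# ≤ h cy + s * - 1# × (∀ k → ℓ cy k + s * 0# ≤ 1#)) → 0# < h cy
      lower (s , 0<s , 0≤h-s , _) = begin-strict
        0#                          <⟨ 0<s ⟩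
        s                           ≡⟨ +-identityˡ s ⟨
        0# + s                      ≤⟨ +-monoˡ-≤ s 0≤h-s ⟩
        (h cy + s * - 1#) + s       ≡⟨ cong ((h cy + s * - 1#) +_) (*-identityʳ s) ⟨
        (h cy + s * - 1#) + s * 1#  ≡⟨ solve 3 (λ c s o → (c :+ s :* :- o) :+ s :* o := c) refl (h cy) s 1# ⟩
        h cy                        ∎
        where open ≤-Reasoning

    interior⇒ℓ<1 : ∀ {y} → InInterior B y → (cy : Coordinates y) → ∀ {j m} → j ≢ m → ℓ cy j < 1#
    interior⇒ℓ<1 y° cy {j} {m} j≢m = shift (interior-perturb y° cy (λ k → δ j k - δ m k) 0# (sum-δ-δ j m))
      where
      shift : (∃ λ s → 0# < s × 0# ≤ h cy + s * 0# × (∀ k → ℓ cy k + s * (δ j k - δ m k) ≤ 1#)) → ℓ cy j < 1#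
      shift (s , 0<s , _ , ℓ+sδ≤1) = begin-strict
        ℓ cy j                              <⟨ x<x+y 0<s ⟩
        ℓ cy j + s                          ≡⟨ cong (ℓ cy j +_) s[1-0]≡s ⟨
        ℓ cy j + s * (1# - 0#)              ≡⟨ cong₂ (λ a b → ℓ cy j + s * (a - b)) (δ-diag j) (δ-offdiag (j≢m ∘ sym)) ⟨
        ℓ cy j + s * (δ j j - δ m j)        ≤⟨ ℓ+sδ≤1 j ⟩
        1#                                  ∎
        where
        open ≤-Reasoning
        s[1-0]≡s : s * (1# - 0#) ≡ s
        s[1-0]≡s = trans (cong (s *_) (trans (cong (1# +_) -0#≈0#) (+-identityʳ 1#))) (*-identityʳ s)

    translate≡point : ∀ {y} (cy : Coordinates y) i c → y +ᵥ point (δ i) c ≡ point (λ k → ℓ cy k + δ i k) (h cy + c)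
    translate≡point cy i c = trans (cong (_+ᵥ point (δ i) c) (y≡point cy)) (point-+ᵥ (ℓ cy) (h cy) (δ i) c)

    Σℓ+δ≡2 : ∀ {y} (cy : Coordinates y) i → sum (λ k → ℓ cy k + δ i k) ≡ 1# + 1#
    Σℓ+δ≡2 cy i = trans (sum-+ (ℓ cy) (δ i)) (cong₂ _+_ (Σℓ≡1 cy) (sum-δ i))

    translate-collision : ∀ {y y′} (cy : Coordinates y) (cy′ : Coordinates y′) → (∀ k → ℓ cy k < 1#) →
      ∀ {i j a b} → y +ᵥ point (δ i) a ≡ y′ +ᵥ point (δ j) b → i ≡ j × h cy + a ≡ h cy′ + b
    translate-collision {y} {y′} cy cy′ ℓ<1 {i} {j} {a} {b} collide =
      decidable-stable (i Fin.≟ j) i≢j-impossible , proj₁ coordinates-agree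
      where
      coordinates-agree : h cy + a ≡ h cy′ + b × (∀ k → ℓ cy k + δ i k ≡ ℓ cy′ k + δ j k)
      coordinates-agree = point-injective (trans (Σℓ+δ≡2 cy i) (sym (Σℓ+δ≡2 cy′ j)))
        (trans (sym (translate≡point cy i a)) (trans collide (translate≡point cy′ j b)))
      i≢j-impossible : ¬ i ≢ j
      i≢j-impossible i≢j = <⇒≱ (ℓ<1 j) (begin
        1#                    ≤⟨ x≤x+y (0≤ℓ cy′ j) ⟩
        1# + ℓ cy′ j          ≡⟨ +-comm 1# (ℓ cy′ j) ⟩
        ℓ cy′ j + 1#          ≡⟨ cong (ℓ cy′ j +_) (δ-diag j) ⟨
        ℓ cy′ j + δ j j       ≡⟨ proj₂ coordinates-agree j ⟨
        ℓ cy j + δ i j        ≡⟨ trans (cong (ℓ cy j +_) (δ-offdiag i≢j)) (+-identityʳ (ℓ cy j)) ⟩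
        ℓ cy j                ∎)
        where open ≤-Reasoning

    B-coordinates : ∀ j → Coordinates (L.lookup B j)
    B-coordinates j = coordinates (δ j , δ-nonNeg j , sum-δ j , sym (vsum-δ j (L.lookup B)))

    ℓB : Fin (length B) → Fin d → Carrier
    ℓB j = ℓ (B-coordinates j)

    hB : Fin (length B) → Carrier
    hB j = h (B-coordinates j)

    coordinates-convex : ∀ {y} (cy : Coordinates y) μ → sum μ ≡ 1# → y ≡ vsum (λ j → μ j ·ᵥ L.lookup B j) →
      h cy ≡ sum (λ j → μ j * hB j) × (∀ k → ℓ cy k ≡ sum (λ j → μ j * ℓB j k))
    coordinates-convex {y} cy μ Σμ≡1 y≡Σμb = point-injective Σℓ-agree points-agree
      where
      points-agree : point (ℓ cy) (h cy) ≡ point (λ k → sum (λ j → μ j * ℓB j k)) (sum (λ j → μ j * hB j))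
      points-agree = begin
        point (ℓ cy) (h cy)                                 ≡⟨ y≡point cy ⟨
        y                                                   ≡⟨ y≡Σμb ⟩
        vsum (λ j → μ j ·ᵥ L.lookup B j)                    ≡⟨ vsum-cong (λ j → cong (μ j ·ᵥ_) (y≡point (B-coordinates j))) ⟩
        vsum (λ j → μ j ·ᵥ point (ℓB j) (hB j))             ≡⟨ vsum-point μ ℓB hB ⟩
        point (λ k → sum (λ j → μ j * ℓB j k)) (sum (λ j → μ j * hB j)) ∎
        where open ≡-Reasoning
      Σℓ-agree : sum (ℓ cy) ≡ sum (λ k → sum (λ j → μ j * ℓB j k))
      Σℓ-agree = begin
        sum (ℓ cy)                                   ≡⟨ trans (Σℓ≡1 cy) (sym Σμ≡1) ⟩
        sum μ                                        ≡⟨ sum-cong (λ j → trans (sym (*-identityʳ (μ j))) (cong (μ j *_) (sym (Σℓ≡1 (B-coordinates j))))) ⟩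
        sum (λ j → μ j * sum (ℓB j))                 ≡⟨ sum-cong (λ j → sym (sum-*ˡ (μ j) (ℓB j))) ⟩
        sum (λ j → sum (λ k → μ j * ℓB j k))         ≡⟨ sum-comm (λ j k → μ j * ℓB j k) ⟩
        sum (λ k → sum (λ j → μ j * ℓB j k))         ∎
        where open ≡-Reasoning

    corner-coordinates : ∀ i {c} → 0# ≤ c → c ≤ t i → Coordinates (point (δ i) c)
    corner-coordinates i {c} 0≤c c≤t = record
      { ℓ = δ i ; h = c ; 0≤ℓ = δ-nonNeg i ; Σℓ≡1 = sum-δ i ; 0≤h = 0≤c
      ; h≤Σℓt = subst (c ≤_) (sym (sum-δ* i t)) c≤t ; y≡point = refl }

    base-corner∈[B] : ∀ i → InHull B (point (δ i) 0#)
    base-corner∈[B] i = proj₂ (hull⇔prism (point (δ i) 0#))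
      (δ i , (λ _ → 0#) , δ-nonNeg i , (λ _ → ≤-refl) , trans (cong₂ _+_ (sum-δ i) (sum-0 d)) (+-identityʳ 1#) ,
       sym (trans (conv2≡point (δ i) (λ _ → 0#)) (point-cong (λ k → +-identityʳ (δ i k)) (trans (sum-cong λ k → zeroˡ (t k)) (sum-0 d)))))

    top-corner∈[B] : ∀ i → InHull B (point (δ i) (t i))
    top-corner∈[B] i = proj₂ (hull⇔prism (point (δ i) (t i)))
      ((λ _ → 0#) , δ i , (λ _ → ≤-refl) , δ-nonNeg i , trans (cong₂ _+_ (sum-0 d) (sum-δ i)) (+-identityˡ 1#) ,
       sym (trans (conv2≡point (λ _ → 0#) (δ i)) (point-cong (λ k → +-identityˡ (δ i k)) (sum-δ* i t))))

    -- ℓ i − slack is at most 1 on [B] and equals 1 at the corner, which is a convex combination of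
    -- points of B; so one of those points attains 1, and that forces it to be the corner.
    corner∈B : ∀ i {c} → 0# ≤ c → c ≤ t i → InHull B (point (δ i) c) →
      (slack : Fin (length B) → Carrier) → (∀ j → 0# ≤ slack j) →
      (∀ {μ : Fin (length B) → Carrier} → c ≡ sum (λ j → μ j * hB j) →
         (∀ k → δ i k ≡ sum (λ j → μ j * ℓB j k)) → sum (λ j → μ j * slack j) ≡ 0#) →
      (∀ j → (∀ k → ℓB j k ≡ δ i k) → slack j ≡ 0# → hB j ≡ c) →
      point (δ i) c ∈ B
    corner∈B i {c} 0≤c c≤t (μ , 0≤μ , Σμ≡1 , c≡Σμb) slack 0≤slack Σμ·slack≡0 slack≡0⇒h≡c =
      pick (convex-extreme {L = λ j → ℓB j i} {s = slack} 0≤μ Σμ≡1 (λ j → ℓ≤1 (B-coordinates j) i) 0≤slack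
              (trans (sym (proj₂ agree i)) (δ-diag i)) (Σμ·slack≡0 (proj₁ agree) (proj₂ agree)))
      where
      agree : c ≡ sum (λ j → μ j * hB j) × (∀ k → δ i k ≡ sum (λ j → μ j * ℓB j k))
      agree = coordinates-convex (corner-coordinates i 0≤c c≤t) μ Σμ≡1 c≡Σμb
      pick : (∃ λ j → ℓB j i ≡ 1# × slack j ≡ 0#) → point (δ i) c ∈ B
      pick (j , ℓji≡1 , slackj≡0) =
        subst (_∈ B) (trans (y≡point (B-coordinates j)) (point-cong ℓj≗δi (slack≡0⇒h≡c j ℓj≗δi slackj≡0))) (∈-lookup j)
        where
        ℓj≗δi : ∀ k → ℓB j k ≡ δ i k
        ℓj≗δi = unit-vector (0≤ℓ (B-coordinates j)) (Σℓ≡1 (B-coordinates j)) ℓji≡1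

    base-corner∈B : ∀ i → point (δ i) 0# ∈ B
    base-corner∈B i = corner∈B i ≤-refl (inj₁ (0<t i)) (base-corner∈[B] i)
      hB (λ j → 0≤h (B-coordinates j)) (λ 0≡Σμh _ → sym 0≡Σμh) (λ _ _ hj≡0 → hj≡0)

    top-corner∈B : ∀ i → point (δ i) (t i) ∈ B
    top-corner∈B i = corner∈B i (inj₁ (0<t i)) ≤-refl (top-corner∈[B] i)
      slack (λ j → x≤y⇒0≤y-x (h≤Σℓt (B-coordinates j))) Σμ·slack≡0 slack≡0⇒h≡t
      where
      open ≡-Reasoning
      Σℓt : Fin (length B) → Carrier
      Σℓt j = sum (λ k → ℓB j k * t k)
      slack : Fin (length B) → Carrier
      slack j = Σℓt j - hB j
      Σμ·slack≡0 : ∀ {μ : Fin (length B) → Carrier} → t i ≡ sum (λ j → μ j * hB j) →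
                   (∀ k → δ i k ≡ sum (λ j → μ j * ℓB j k)) → sum (λ j → μ j * slack j) ≡ 0#
      Σμ·slack≡0 {μ} t≡Σμh δ≡Σμℓ = begin
        sum (λ j → μ j * slack j)
          ≡⟨ sum-cong (λ j → solve 3 (λ m a b → m :* (a :- b) := m :* a :- m :* b) refl (μ j) (Σℓt j) (hB j)) ⟩
        sum (λ j → (μ j * Σℓt j) - (μ j * hB j))
          ≡⟨ sum-- (λ j → μ j * Σℓt j) (λ j → μ j * hB j) ⟩
        sum (λ j → μ j * Σℓt j) - sum (λ j → μ j * hB j)
          ≡⟨ cong₂ _-_ Σμ·Σℓt≡t (sym t≡Σμh) ⟩
        t i - t i
          ≡⟨ -‿inverseʳ (t i) ⟩
        0# ∎
        where
        Σμ·Σℓt≡t : sum (λ j → μ j * Σℓt j) ≡ t i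
        Σμ·Σℓt≡t = begin
          sum (λ j → μ j * Σℓt j)
            ≡⟨ sum-cong (λ j → sym (sum-*ˡ (μ j) (λ k → ℓB j k * t k))) ⟩
          sum (λ j → sum (λ k → μ j * (ℓB j k * t k)))
            ≡⟨ sum-comm (λ j k → μ j * (ℓB j k * t k)) ⟩
          sum (λ k → sum (λ j → μ j * (ℓB j k * t k)))
            ≡⟨ sum-cong (λ k → trans (sum-cong λ j → sym (*-assoc (μ j) (ℓB j k) (t k))) (sum-*ʳ (t k) (λ j → μ j * ℓB j k))) ⟩
          sum (λ k → sum (λ j → μ j * ℓB j k) * t k)
            ≡⟨ sum-cong (λ k → cong (_* t k) (δ≡Σμℓ k)) ⟨
          sum (λ k → δ i k * t k)
            ≡⟨ sum-δ* i t ⟩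
          t i ∎
      slack≡0⇒h≡t : ∀ j → (∀ k → ℓB j k ≡ δ i k) → slack j ≡ 0# → hB j ≡ t i
      slack≡0⇒h≡t j ℓj≗δi slackj≡0 = begin
        hB j                       ≡⟨ x-y≡0⇒x≡y slackj≡0 ⟨
        sum (λ k → ℓB j k * t k)   ≡⟨ sum-cong (λ k → cong (_* t k) (ℓj≗δi k)) ⟩
        sum (λ k → δ i k * t k)    ≡⟨ sum-δ* i t ⟩
        t i                        ∎

    module Counting (2≤d : 2 ℕ.≤ d) {A : List (Point d)} (A-unique : Unique A) (A≢[] : A ≢ [])
      (x : Point d) (x+A⊆int : ∀ {a} → a ∈ A → InInterior B (x +ᵥ a)) where

      n : ℕ
      n = length A

      a : Fin n → Point d
      a = L.lookup A

      interior : ∀ k → InInterior B (x +ᵥ a k)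
      interior k = x+A⊆int (∈-lookup k)

      ca : ∀ k → Coordinates (x +ᵥ a k)
      ca k = coordinates (interior⇒hull (interior k))

      ℓ<1 : ∀ k m → ℓ (ca k) m < 1#
      ℓ<1 k m = interior⇒ℓ<1 (interior k) (ca k) (proj₂ (another-index 2≤d m))

      tallest : ∃ λ i → ∀ k → t k ≤ t i
      tallest = argmax (Fin.fromℕ< 2≤d) t

      i* : Fin d
      i* = proj₁ tallest

      j° : Fin d
      j° = proj₁ (another-index 2≤d i*)

      highest : ∃ λ k → ∀ k′ → h (ca k′) ≤ h (ca k)
      highest = argmax (nonempty-index A≢[]) (h ∘ ca)

      top : Fin n
      top = proj₁ highest

      corner : Fin (suc d) → Fin d
      corner zero = i*
      corner (suc i) = i

      height : Fin (suc d) → Carrier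
      height zero = t i*
      height (suc _) = 0#

      b : Fin (suc d) → Point d
      b i = point (δ (corner i)) (height i)

      b∈B : ∀ i → b i ∈ B
      b∈B zero = top-corner∈B i*
      b∈B (suc i) = base-corner∈B i

      collision : ∀ {k k′ i j c c′} → a k +ᵥ point (δ i) c ≡ a k′ +ᵥ point (δ j) c′ → i ≡ j × h (ca k) + c ≡ h (ca k′) + c′
      collision {k} {k′} {i} {j} {c} {c′} eq = translate-collision (ca k) (ca k′) (ℓ<1 k)
        (trans (+ᵥ-assoc x (a k) (point (δ i) c)) (trans (cong (x +ᵥ_) eq) (sym (+ᵥ-assoc x (a k′) (point (δ j) c′)))))

      F : Fin (suc d) × Fin n → Point d
      F (i , k) = a k +ᵥ b i

      F-injective : ∀ {p q} → F p ≡ F q → p ≡ q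
      F-injective {i , k} {i′ , k′} eq with i Fin.≟ i′
      ... | yes refl = cong (i ,_) (lookup-injective A-unique (+ᵥ-cancelʳ (b i) eq))
      ... | no i≢i′ = ⊥-elim (separated i i′ i≢i′ (collision eq))
        where
        top≠base : ∀ {k k′} → h (ca k) + t i* ≢ h (ca k′) + 0#
        top≠base {k} {k′} eq′ = <-irrefl (trans (sym eq′) (+-comm (h (ca k)) (t i*)))
          (+-mono-≤-< (h≤max (ca k′) (proj₂ tallest)) (interior⇒0<h (interior k) (ca k)))
        separated : ∀ {k k′} i i′ → i ≢ i′ → ¬ (corner i ≡ corner i′ × h (ca k) + height i ≡ h (ca k′) + height i′)
        separated zero zero 0≢0 _ = 0≢0 refl
        separated zero (suc _) _ (_ , heights) = top≠base heights
        separated (suc _) zero _ (_ , heights) = top≠base (sym heights)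
        separated (suc i) (suc i′) i≢i′ (i≡i′ , _) = i≢i′ (cong suc i≡i′)

      apex : Point d
      apex = a top +ᵥ point (δ j°) (t j°)

      apex∉F : ∀ p → apex ≢ F p
      apex∉F (i , k) eq = separated i (collision eq)
        where
        separated : ∀ i → ¬ (j° ≡ corner i × h (ca top) + t j° ≡ h (ca k) + height i)
        separated zero (j°≡i* , _) = proj₂ (another-index 2≤d i*) (sym j°≡i*)
        separated (suc _) (_ , heights) = <-irrefl (sym heights)
          (+-mono-≤-< (proj₂ highest k) (0<t j°))

      witnesses : List (Point d)
      witnesses = apex ∷ L.tabulate (F ∘ Fin.remQuot n)

      witnesses-unique : Unique witnesses
      witnesses-unique = All.tabulate⁺ (apex∉F ∘ Fin.remQuot n)
                       ∷ Unique.tabulate⁺ (remQuot-injective n ∘ F-injective)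

      F∈A+B : ∀ p → InSumset A B (F p)
      F∈A+B (i , k) = a k , b i , ∈-lookup k , b∈B i , refl

      witnesses⊆A+B : ∀ {p} → p ∈ witnesses → InSumset A B p
      witnesses⊆A+B (here refl) = a top , point (δ j°) (t j°) , ∈-lookup top , top-corner∈B j° , refl
      witnesses⊆A+B (there p∈) with ∈-tabulate⁻ p∈
      ... | m , refl = F∈A+B (Fin.remQuot n m)

      witnesses-many : suc d ℕ.* n ℕ.< length witnesses
      witnesses-many = ℕ.s≤s (ℕₚ.≤-reflexive (sym (length-tabulate (F ∘ Fin.remQuot n))))

lemma9p1 : (R : RealField) → let open Geometry R in
    (d : ℕ) → 2 ℕ.≤ d →
    (A B : List (Point d)) → Unique A → A ≢ [] →
    (∃ λ (x : Point d) → ∀ {a} → a ∈ A → InInterior B (x +ᵥ a)) →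
    IsParallelPrism B →
    SumsetSizeExceeds A B (suc d ℕ.* length A)
lemma9p1 R d 2≤d A B A-unique A≢[] (x , x+A⊆int) (v , w , u , t , independent , 0<t , w≡v+tu , hull⇔prism) =
  witnesses , witnesses-unique , witnesses⊆A+B , witnesses-many
  where
  open Prism R B independent 0<t w≡v+tu hull⇔prism
  open Counting 2≤d A-unique A≢[] x x+A⊆int
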